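{- Let $\vec c=(c_1,\dots,c_k)$ be a composition of $n$ with $c_k>0$, let $\alpha\in\mathfrak S_n$ have descent composition $\vec c$, and let $\gamma\in\mathfrak S^c_{\vec c}$. Then $\alpha\circ\gamma\le\alpha$ in the weak Bruhat order.
   Context: The descent composition of $\alpha=\alpha_1\cdots\alpha_n\in\mathfrak S_n$ with descent set $\{i:\alpha_i>\alpha_{i+1}\}=\{s_1<\dots<s_{k-1}\}$ is $(s_1,s_2-s_1,\dots,n-s_{k-1})$. The (right) weak Bruhat order on $\mathfrak S_n$ is generated by the cover relations $\alpha\prec\alpha\circ(i,i+1)$ whenever $\alpha_i<\alpha_{i+1}$, where $\alpha\circ\gamma$ is the permutation $j\mapsto\alpha_{\gamma(j)}$ (so $\alpha\circ(i,i+1)$ swaps the entries in positions $i,i+1$). The column intervals $K_1,\dots,K_{n-k+1}$ of $\vec c$ are the maximal intervals of $[n]$ such that $j$ and $j+1$ lie in the same interval iff $j\in\{c_1,c_1+c_2,\dots,c_1+\dots+c_{k-1}\}$; $\mathfrak S^c_{\vec c}=\mathfrak S_{K_1}\times\cdots\times\mathfrak S_{K_{n-k+1}}\subseteq\mathfrak S_n$. -}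

module Defs where

open import Data.Nat using (ℕ; zero; suc; _+_; _∸_; _<_; _≤_; _<ᵇ_)
open import Data.Nat using () renaming (_⊔_ to max; _⊓_ to min)
open import Data.Bool using (if_then_else_)
open import Data.List using (List; []; _∷_; map; allFin; _∷ʳ_)
open import Data.Nat.ListAction using (sum)
open import Data.List.Membership.Propositional using (_∈_)
open import Data.Fin using (Fin; toℕ)
open import Data.Fin.Permutation using (Permutation′; _⟨$⟩ʳ_; _∘ₚ_)
open import Data.Fin.Permutation.Components using (transpose)
open import Data.Product using (Σ; _×_; ∃)
open import Relation.Binary.PropositionalEquality using (_≡_)

-- Permutations of [n] are represented by 'Permutation′ n' (bijections Fin n ↔ Fin n);
-- positions and values are 0-indexed internally (position p here is position p+1 in the paper).

-- α ∘ γ is the permutation  j ↦ α (γ j).  (stdlib's _∘ₚ_ is diagrammatic.)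
_⊚_ : ∀ {n} → Permutation′ n → Permutation′ n → Permutation′ n
α ⊚ γ = γ ∘ₚ α

oneLine : ∀ {n} → Permutation′ n → List ℕ
oneLine {n} α = map (λ j → toℕ (α ⟨$⟩ʳ j)) (allFin n)

-- descents of a word: the 1-indexed positions i with w_i > w_{i+1}, in increasing order.
-- 'desAux k w' assumes the first letter of w is at (1-indexed) position k.
desAux : ℕ → List ℕ → List ℕ
desAux k [] = []
desAux k (x ∷ []) = []
desAux k (x ∷ y ∷ r) = if y <ᵇ x then k ∷ desAux (suc k) (y ∷ r) else desAux (suc k) (y ∷ r)

descentSet : ∀ {n} → Permutation′ n → List ℕ
descentSet α = desAux 1 (oneLine α)

compAux : ℕ → ℕ → List ℕ → List ℕ
compAux n prev [] = n ∸ prev ∷ []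
compAux n prev (s ∷ ss) = (s ∸ prev) ∷ compAux n s ss

descentComposition : ∀ {n} → Permutation′ n → List ℕ
descentComposition {n} α = compAux n 0 (descentSet α)

IsCompositionLastPos : ℕ → List ℕ → Set
IsCompositionLastPos n c = sum c ≡ n × Σ (List ℕ) (λ c′ → Σ ℕ (λ ck → c ≡ c′ ∷ʳ ck × 0 < ck))

innerSums : List ℕ → List ℕ
innerSums [] = []
innerSums (c ∷ []) = []
innerSums (c ∷ d ∷ r) = c ∷ map (c +_) (innerSums (d ∷ r))

-- 1-indexed positions a, b lie in the same column interval of c iff every
-- j with min a b ≤ j < max a b lies in innerSums c (j and j+1 are then joined).
SameColumn : List ℕ → ℕ → ℕ → Set
SameColumn c a b = ∀ j → min a b ≤ j → j < max a b → j ∈ innerSums c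

-- γ ∈ 𝔖^c_c = 𝔖_{K_1} × ⋯ × 𝔖_{K_{n-k+1}} : γ maps every column interval to itself,
-- i.e. every position is sent into its own column interval.
InColumnGroup : ∀ {n} → List ℕ → Permutation′ n → Set
InColumnGroup c γ = ∀ j → SameColumn c (suc (toℕ j)) (suc (toℕ (γ ⟨$⟩ʳ j)))

-- cover relation of the right weak order: β = α ∘ (i,i+1) with α_i < α_{i+1}
Cover : ∀ {n} → Permutation′ n → Permutation′ n → Set
Cover {n} α β = Σ (Fin n) λ i → Σ (Fin n) λ i′ →
  toℕ i′ ≡ suc (toℕ i) × toℕ (α ⟨$⟩ʳ i) < toℕ (α ⟨$⟩ʳ i′) ×
  (∀ k → β ⟨$⟩ʳ k ≡ α ⟨$⟩ʳ (transpose i i′ k))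

-- the weak (Bruhat) order: reflexive-transitive closure of Cover
-- (permutations compared pointwise, since functions lack extensional equality)
data _≤W_ {n : ℕ} : Permutation′ n → Permutation′ n → Set where
  ≤W-refl : ∀ {α β} → (∀ k → α ⟨$⟩ʳ k ≡ β ⟨$⟩ʳ k) → α ≤W β
  ≤W-step : ∀ {α β δ} → Cover α β → β ≤W δ → α ≤W δ

module Submission where

-- The column intervals of c are the maximal blocks of consecutive
-- positions linked by "joins", the partial sums c₁, c₁+c₂, ….  When c is the descent
-- composition of α every join is a descent of α, so α is decreasing on every
-- block.  A permutation γ that maps every block to itself is sorted by bubble sort:
-- while γ has an adjacent descent γ(i) > γ(i+1), the positions i, i+1 lie in one block
-- (blocks are intervals), hence α(γ i) < α(γ(i+1)) and α∘γ is covered by α∘γ∘(i,i+1)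
-- in the weak order; the swapped permutation again preserves the blocks.  The potential
-- Φ γ = Σₖ k·(n − γ k) drops at each swap, and a permutation without adjacent descents
-- is the identity, where the chain of covers ends at α.

open import Defs
open import Data.Nat using (ℕ; zero; suc; _+_; _*_; _∸_; _≤_; _<_; z≤n; s≤s; s≤s⁻¹; z<s; _<ᵇ_; _⊓_; _⊔_)
open import Data.Nat.Properties
open import Data.Nat.Induction using (<-wellFounded)
open import Data.Bool using (true; false; T; if_then_else_)
open import Data.Unit using (tt)
open import Data.Maybe using (Maybe; just; nothing)
open import Data.Maybe.Properties using (just-injective)
open import Data.List using (List; []; _∷_; tabulate)
open import Data.List.Properties using (map-tabulate)
open import Data.List.Relation.Unary.Any using (here; there)
open import Data.List.Relation.Unary.Linked using (Linked; [-]; _∷_)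
open import Data.List.Membership.Propositional using (_∈_)
open import Data.List.Membership.Propositional.Properties using (∈-map⁻)
open import Data.Fin using (Fin; toℕ; fromℕ<; punchIn; punchOut) renaming (zero to fzero; suc to fsuc; _≟_ to _≟ᶠ_)
open import Data.Fin.Properties using (toℕ<n; toℕ-fromℕ<; toℕ-injective; any?; punchInᵢ≢i; punchIn-injective; punchIn-punchOut)
open import Data.Fin.Permutation using (Permutation′; _⟨$⟩ʳ_; _⟨$⟩ˡ_; _∘ₚ_; inverseˡ)
import Data.Fin.Permutation as Perm
open import Data.Fin.Permutation.Components using (transpose)
open import Data.Vec.Functional using (removeAt)
open import Algebra.Properties.CommutativeMonoid.Sum +-0-commutativeMonoid using (sum; sum-remove; sum-cong-≗)
open import Data.Product using (Σ; _×_; ∃-syntax; _,_; proj₁; swap)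
open import Data.Sum using (_⊎_; inj₁; inj₂)
open import Induction.WellFounded using (Acc; acc)
open import Relation.Nullary using (Dec; ¬_; yes; no; contradiction)
open import Relation.Nullary.Decidable using (_×-dec_)
open import Relation.Binary.PropositionalEquality
open import Data.Nat.Tactic.RingSolver using (solve-∀)

-- Blocks of a set D ⊆ ℕ of joins: a and b are in one block when every gap j between
-- them (a ≤ j < b or b ≤ j < a, gap j linking j and j+1) is a join.

module Blocks (D : ℕ → Set) where

  JoinedUpTo : ℕ → ℕ → Set
  JoinedUpTo a b = ∀ j → a ≤ j → j < b → D j

  SameBlock : ℕ → ℕ → Set
  SameBlock a b = JoinedUpTo a b × JoinedUpTo b a

  joined-empty : ∀ {a b} → b ≤ a → JoinedUpTo a b
  joined-empty b≤a j a≤j j<b = contradiction (≤-<-trans (≤-trans b≤a a≤j) j<b) (<-irrefl refl)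

  joined-cover : ∀ {a b b′ c} → b′ ≤ b → JoinedUpTo a b → JoinedUpTo b′ c → JoinedUpTo a c
  joined-cover {b = b} b′≤b ab b′c j a≤j j<c with j <? b
  ... | yes j<b = ab j a≤j j<b
  ... | no j≮b = b′c j (≤-trans b′≤b (≮⇒≥ j≮b)) j<c

  sameBlock-refl : ∀ {a} → SameBlock a a
  sameBlock-refl = joined-empty ≤-refl , joined-empty ≤-refl

  sameBlock-sym : ∀ {a b} → SameBlock a b → SameBlock b a
  sameBlock-sym = swap

  sameBlock-trans : ∀ {a b c} → SameBlock a b → SameBlock b c → SameBlock a c
  sameBlock-trans (ab , ba) (bc , cb) = joined-cover ≤-refl ab bc , joined-cover ≤-refl cb ba

  sameBlock-fromMinMax : ∀ {a b} → (∀ j → a ⊓ b ≤ j → j < a ⊔ b → D j) → SameBlock a b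
  sameBlock-fromMinMax {a} {b} h =
      (λ j a≤j j<b → h j (≤-trans (m⊓n≤m a b) a≤j) (<-≤-trans j<b (m≤n⊔m a b)))
    , (λ j b≤j j<a → h j (≤-trans (m⊓n≤n a b) b≤j) (<-≤-trans j<a (m≤m⊔n a b)))

  -- blocks are intervals: if x ≤ y are in blocks containing x′ and y′ with y′ ≤ x′,
  -- the two blocks overlap, so x and y share a block
  crossing : ∀ {x x′ y y′} → SameBlock x x′ → SameBlock y y′ → x ≤ y → y′ ≤ x′ → SameBlock x y
  crossing (xx′ , _) (_ , y′y) x≤y y′≤x′ = joined-cover y′≤x′ xx′ y′y , joined-empty x≤y

-- Positions.  Internally positions are 0-indexed; pos gives the 1-indexed position.

pos : ∀ {n} → Fin n → ℕ
pos k = suc (toℕ k)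

predecessor : ∀ {n} (q : Fin n) {m} → toℕ q ≡ suc m → Σ (Fin n) λ r → toℕ q ≡ suc (toℕ r)
predecessor {n} q {m} q≡ = fromℕ< m<n , trans q≡ (cong suc (sym (toℕ-fromℕ< m<n)))
  where
  m<n : m < n
  m<n = <-trans (n<1+n m) (subst (_< n) q≡ (toℕ<n q))

successor : ∀ {n} (k : Fin n) → suc (toℕ k) < n → Σ (Fin n) λ k′ → toℕ k′ ≡ suc (toℕ k)
successor k k+1<n = fromℕ< k+1<n , toℕ-fromℕ< k+1<n

adjacent-distinct : ∀ {n} {i i′ : Fin n} → toℕ i′ ≡ suc (toℕ i) → i ≢ i′
adjacent-distinct i′≡ i≡i′ = 1+n≢n (sym (trans (cong toℕ i≡i′) i′≡))

permutation-injective : ∀ {n} (π : Permutation′ n) {i j} → π ⟨$⟩ʳ i ≡ π ⟨$⟩ʳ j → i ≡ j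
permutation-injective π πi≡πj = trans (sym (inverseˡ π)) (trans (cong (π ⟨$⟩ˡ_) πi≡πj) (inverseˡ π))

letter : List ℕ → ℕ → Maybe ℕ
letter [] _ = nothing
letter (x ∷ _) zero = just x
letter (_ ∷ xs) (suc d) = letter xs d

DescentAt : List ℕ → ℕ → Set
DescentAt w d = Σ ℕ λ a → Σ ℕ λ b → letter w d ≡ just a × letter w (suc d) ≡ just b × b < a

desAux-step : ∀ k x y r j → j ∈ desAux k (x ∷ y ∷ r) → (j ≡ k × y < x) ⊎ j ∈ desAux (suc k) (y ∷ r)
desAux-step k x y r j mem with y <ᵇ x in y<ᵇx
desAux-step k x y r j (here j≡k) | true = inj₁ (j≡k , <ᵇ⇒< y x (subst T (sym y<ᵇx) tt))
desAux-step k x y r j (there mem) | true = inj₂ mem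
desAux-step k x y r j mem | false = inj₂ mem

desAux-sound : ∀ k w j → j ∈ desAux k w → ∃[ d ] (j ≡ k + d × DescentAt w d)
desAux-sound k [] j ()
desAux-sound k (x ∷ []) j ()
desAux-sound k (x ∷ y ∷ r) j mem =
  descentHere-or-later (desAux-sound (suc k) (y ∷ r) j) (desAux-step k x y r j mem)
  where
  descentHere-or-later : (j ∈ desAux (suc k) (y ∷ r) → ∃[ d ] (j ≡ suc k + d × DescentAt (y ∷ r) d)) →
    (j ≡ k × y < x) ⊎ j ∈ desAux (suc k) (y ∷ r) → ∃[ d ] (j ≡ k + d × DescentAt (x ∷ y ∷ r) d)
  descentHere-or-later _ (inj₁ (j≡k , y<x)) = 0 , trans j≡k (sym (+-identityʳ k)) , x , y , refl , refl , y<x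
  descentHere-or-later later (inj₂ mem′) with later mem′
  ... | d , j≡ , desc = suc d , trans j≡ (sym (+-suc k d)) , desc

letter-tabulate : ∀ {n} (h : Fin n → ℕ) (i : Fin n) → letter (tabulate h) (toℕ i) ≡ just (h i)
letter-tabulate h fzero = refl
letter-tabulate h (fsuc i) = letter-tabulate (λ k → h (fsuc k)) i

letter-oneLine : ∀ {n} (α : Permutation′ n) (i : Fin n) {m a} → toℕ i ≡ m →
  letter (oneLine α) m ≡ just a → a ≡ toℕ (α ⟨$⟩ʳ i)
letter-oneLine α i refl mᵗʰ-letter = just-injective (begin
  just _                    ≡⟨ sym mᵗʰ-letter ⟩
  letter (oneLine α) (toℕ i) ≡⟨ cong (λ w → letter w (toℕ i)) (map-tabulate (λ x → x) (λ j → toℕ (α ⟨$⟩ʳ j))) ⟩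
  letter (tabulate (λ j → toℕ (α ⟨$⟩ʳ j))) (toℕ i) ≡⟨ letter-tabulate _ i ⟩
  just (toℕ (α ⟨$⟩ʳ i))      ∎)
  where open ≡-Reasoning

-- a (1-indexed) descent i+1 of α means α(i) > α(i+1) (0-indexed positions)
descentSet-sound : ∀ {n} (α : Permutation′ n) (i i′ : Fin n) → toℕ i′ ≡ suc (toℕ i) →
  suc (toℕ i) ∈ descentSet α → toℕ (α ⟨$⟩ʳ i′) < toℕ (α ⟨$⟩ʳ i)
descentSet-sound α i i′ i′≡ mem with desAux-sound 1 (oneLine α) (suc (toℕ i)) mem
... | d , i+1≡ , a , b , aᵈ , bᵈ⁺¹ , b<a with suc-injective i+1≡
... | refl = subst₂ _<_ (letter-oneLine α i′ i′≡ bᵈ⁺¹) (letter-oneLine α i refl aᵈ) b<a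

desAux-increasing : ∀ p k w → p ≤ k → Linked _≤_ (p ∷ desAux k w)
desAux-increasing p k [] _ = [-]
desAux-increasing p k (x ∷ []) _ = [-]
desAux-increasing p k (x ∷ y ∷ r) p≤k =
  consIf (y <ᵇ x) (desAux-increasing k (suc k) (y ∷ r) (n≤1+n k))
                  (desAux-increasing p (suc k) (y ∷ r) (m≤n⇒m≤1+n p≤k))
  where
  rest : List ℕ
  rest = desAux (suc k) (y ∷ r)
  consIf : ∀ b → Linked _≤_ (k ∷ rest) → Linked _≤_ (p ∷ rest) →
           Linked _≤_ (p ∷ (if b then k ∷ rest else rest))
  consIf true k∷rest _ = p≤k ∷ k∷rest
  consIf false _ p∷rest = p∷rest

innerSums-compAux : ∀ n p ss j → Linked _≤_ (p ∷ ss) → j ∈ innerSums (compAux n p ss) → p + j ∈ ss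
innerSums-compAux n p (s ∷ []) j (p≤s ∷ _) (here refl) = here (m+[n∸m]≡n p≤s)
innerSums-compAux n p (s ∷ t ∷ ts) j (p≤s ∷ _) (here refl) = here (m+[n∸m]≡n p≤s)
innerSums-compAux n p (s ∷ t ∷ ts) j (p≤s ∷ s≤ts) (there mem) with ∈-map⁻ ((s ∸ p) +_) mem
... | j′ , mem′ , refl = there (subst (_∈ t ∷ ts) s+j′≡ (innerSums-compAux n s (t ∷ ts) j′ s≤ts mem′))
  where
  s+j′≡ : s + j′ ≡ p + ((s ∸ p) + j′)
  s+j′≡ = trans (cong (_+ j′) (sym (m+[n∸m]≡n p≤s))) (+-assoc p (s ∸ p) j′)

joins-are-descents : ∀ {n} (α : Permutation′ n) j → j ∈ innerSums (descentComposition α) → j ∈ descentSet α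
joins-are-descents α j = innerSums-compAux _ 0 (descentSet α) j (desAux-increasing 0 1 (oneLine α) z≤n)

module DecreasingOnBlocks {n} (α : Permutation′ n) where
  open Blocks (_∈ descentSet α)

  value : Fin n → ℕ
  value k = toℕ (α ⟨$⟩ʳ k)

  decreasing-run : ∀ d (p q : Fin n) → toℕ q ≡ suc (d + toℕ p) → JoinedUpTo (pos p) (pos q) → value q < value p
  decreasing-run zero p q q≡ joined = descentSet-sound α p q q≡ (joined (pos p) ≤-refl (s≤s (≤-reflexive (sym q≡))))
  decreasing-run (suc d) p q q≡ joined with predecessor q q≡
  ... | r , q≡r+1 = <-trans (descentSet-sound α r q q≡r+1 (joined (pos r) (s≤s p≤r) (s≤s r<q)))
                            (decreasing-run d p r r≡ (λ j p≤j j<r → joined j p≤j (<-trans j<r (s≤s r<q))))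
    where
    r≡ : toℕ r ≡ suc (d + toℕ p)
    r≡ = suc-injective (trans (sym q≡r+1) q≡)
    p≤r : toℕ p ≤ toℕ r
    p≤r = ≤-trans (m≤n+m (toℕ p) d) (≤-trans (n≤1+n _) (≤-reflexive (sym r≡)))
    r<q : toℕ r < toℕ q
    r<q = ≤-reflexive (sym q≡r+1)

  decreasing-on-blocks : ∀ {p q : Fin n} → toℕ p < toℕ q → JoinedUpTo (pos p) (pos q) → value q < value p
  decreasing-on-blocks {p} {q} p<q = decreasing-run (toℕ q ∸ pos p) p q
    (sym (trans (cong suc (+-comm (toℕ q ∸ pos p) (toℕ p))) (m+[n∸m]≡n p<q)))

transpose-left : ∀ {n} (i j : Fin n) → transpose i j i ≡ j
transpose-left i j with i ≟ᶠ i
... | yes _ = refl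
... | no i≢i = contradiction refl i≢i

transpose-right : ∀ {n} (i j : Fin n) → i ≢ j → transpose i j j ≡ i
transpose-right i j i≢j with j ≟ᶠ i
... | yes j≡i = contradiction (sym j≡i) i≢j
... | no _ with j ≟ᶠ j
...   | yes _ = refl
...   | no j≢j = contradiction refl j≢j

transpose-other : ∀ {n} (i j k : Fin n) → k ≢ i → k ≢ j → transpose i j k ≡ k
transpose-other i j k k≢i k≢j with k ≟ᶠ i
... | yes k≡i = contradiction k≡i k≢i
... | no _ with k ≟ᶠ j
...   | yes k≡j = contradiction k≡j k≢j
...   | no _ = refl

transpose-related : ∀ {n} (R : Fin n → Fin n → Set) → (∀ {k} → R k k) → (∀ {k l} → R k l → R l k) →
  ∀ {i j} → i ≢ j → R i j → ∀ k → R k (transpose i j k)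
transpose-related R R-refl R-sym {i} {j} i≢j Rij k = by-cases (k ≟ᶠ i) (k ≟ᶠ j)
  where
  by-cases : Dec (k ≡ i) → Dec (k ≡ j) → R k (transpose i j k)
  by-cases (yes refl) _ = subst (R k) (sym (transpose-left i j)) Rij
  by-cases (no _) (yes refl) = subst (R k) (sym (transpose-right i j i≢j)) (R-sym Rij)
  by-cases (no k≢i) (no k≢j) = subst (R k) (sym (transpose-other i j k k≢i k≢j)) R-refl

sum-one-point : ∀ {m} (f g : Fin m → ℕ) k → (∀ l → l ≢ k → f l ≡ g l) → sum f + g k ≡ sum g + f k
sum-one-point {suc m} f g k agree = begin
  sum f + g k                      ≡⟨ cong (_+ g k) (sum-remove {i = k} f) ⟩
  f k + sum (removeAt f k) + g k   ≡⟨ cong (λ s → f k + s + g k) (sum-cong-≗ (λ l → agree (punchIn k l) (punchInᵢ≢i k l))) ⟩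
  f k + sum (removeAt g k) + g k   ≡⟨ swap-outer (f k) (sum (removeAt g k)) (g k) ⟩
  g k + sum (removeAt g k) + f k   ≡⟨ cong (_+ f k) (sym (sum-remove {i = k} g)) ⟩
  sum g + f k                      ∎
  where
  open ≡-Reasoning
  swap-outer : ∀ a s b → a + s + b ≡ b + s + a
  swap-outer = solve-∀

exchange-arith : ∀ a b x y u v → a + v ≡ b + u → x + u < y + v → x + a < y + b
exchange-arith a b x y u v a+v≡b+u x+u<y+v =
  +-cancelʳ-< v (x + a) (y + b) (subst₂ _<_ lhs rhs (+-monoˡ-< b x+u<y+v))
  where
  lhs : x + u + b ≡ x + a + v
  lhs = begin
    x + u + b    ≡⟨ +-assoc x u b ⟩
    x + (u + b)  ≡⟨ cong (x +_) (trans (+-comm u b) (sym a+v≡b+u)) ⟩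
    x + (a + v)  ≡⟨ sym (+-assoc x a v) ⟩
    x + a + v    ∎
    where open ≡-Reasoning
  rhs : y + v + b ≡ y + b + v
  rhs = trans (+-assoc y v b) (trans (cong (y +_) (+-comm v b)) (sym (+-assoc y b v)))

sum-exchange : ∀ {m} (f g : Fin m → ℕ) {i j} → i ≢ j → (∀ l → l ≢ i → l ≢ j → f l ≡ g l) →
  f i + f j < g i + g j → sum f < sum g
sum-exchange {suc m} f g {i} {j} i≢j agree fᵢⱼ<gᵢⱼ =
  subst₂ _<_ (sym (sum-remove {i = i} f)) (sym (sum-remove {i = i} g))
    (exchange-arith _ _ (f i) (g i) _ _ rest-balance
      (subst₂ (λ u v → f i + u < g i + v) (sym (cong f j′↦j)) (sym (cong g j′↦j)) fᵢⱼ<gᵢⱼ))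
  where
  j′ : Fin m
  j′ = punchOut i≢j
  j′↦j : punchIn i j′ ≡ j
  j′↦j = punchIn-punchOut i≢j
  -- after removing i, the functions differ only at the image j′ of j
  rest-balance : sum (removeAt f i) + g (punchIn i j′) ≡ sum (removeAt g i) + f (punchIn i j′)
  rest-balance = sum-one-point (removeAt f i) (removeAt g i) j′
    (λ l l≢j′ → agree (punchIn i l) (punchInᵢ≢i i l)
                       (λ e → l≢j′ (punchIn-injective i l j′ (trans e (sym j′↦j)))))

-- The potential  Φ γ = Σₖ k · (n − γ k); it drops when an adjacent descent is swapped.
Φ : ∀ {n} → Permutation′ n → ℕ
Φ {n} γ = sum (λ k → toℕ k * (n ∸ toℕ (γ ⟨$⟩ʳ k)))

swap-weights : ∀ t x y → x < y → t * y + suc t * x < t * x + suc t * y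
swap-weights t x y x<y = subst₂ _<_ (sym (moved t x y)) (sym (kept t x y)) (+-monoˡ-< (t * x + t * y) x<y)
  where
  moved : ∀ t x y → t * y + suc t * x ≡ x + (t * x + t * y)
  moved = solve-∀
  kept : ∀ t x y → t * x + suc t * y ≡ y + (t * x + t * y)
  kept = solve-∀

-- swapping an adjacent descent γ(i) > γ(i+1) lowers Φ: only the terms at i, i+1 change
Φ-swap : ∀ {n} (γ : Permutation′ n) {i i′ : Fin n} → toℕ i′ ≡ suc (toℕ i) →
  toℕ (γ ⟨$⟩ʳ i′) < toℕ (γ ⟨$⟩ʳ i) → Φ (Perm.transpose i i′ ∘ₚ γ) < Φ γ
Φ-swap {n} γ {i} {i′} i′≡ γi′<γi = sum-exchange _ _ i≢i′
  (λ k k≢i k≢i′ → cong (λ l → toℕ k * weight l) (transpose-other i i′ k k≢i k≢i′))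
  (subst₂ _<_ (sym swapped) (sym original) (swap-weights (toℕ i) (weight i) (weight i′) weight-i<i′))
  where
  weight : Fin n → ℕ
  weight k = n ∸ toℕ (γ ⟨$⟩ʳ k)
  i≢i′ : i ≢ i′
  i≢i′ = adjacent-distinct i′≡
  weight-i<i′ : weight i < weight i′
  weight-i<i′ = ∸-monoʳ-< γi′<γi (<⇒≤ (toℕ<n (γ ⟨$⟩ʳ i)))
  swapped : toℕ i * weight (transpose i i′ i) + toℕ i′ * weight (transpose i i′ i′)
          ≡ toℕ i * weight i′ + suc (toℕ i) * weight i
  swapped = cong₂ _+_ (cong (λ l → toℕ i * weight l) (transpose-left i i′))
                      (cong₂ (λ t l → t * weight l) i′≡ (transpose-right i i′ i≢i′))
  original : toℕ i * weight i + toℕ i′ * weight i′ ≡ toℕ i * weight i + suc (toℕ i) * weight i′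
  original = cong (λ t → toℕ i * weight i + t * weight i′) i′≡

-- A self-map of Fin n that increases at every adjacent step is the identity: it can
-- neither fall below the diagonal (counting up from 0) nor rise above it (counting
-- down from n − 1).
module IncreasingSelfMap {n} (f : Fin n → Fin n)
  (increasing : ∀ i i′ → toℕ i′ ≡ suc (toℕ i) → toℕ (f i) < toℕ (f i′)) where

  above-diagonal : ∀ m (k : Fin n) → toℕ k ≡ m → m ≤ toℕ (f k)
  above-diagonal zero k _ = z≤n
  above-diagonal (suc m) k k≡ with predecessor k k≡
  ... | r , k≡r+1 = ≤-<-trans (above-diagonal m r (suc-injective (trans (sym k≡r+1) k≡))) (increasing r k k≡r+1)

  below-diagonal : ∀ e (k : Fin n) → toℕ k + e < n → toℕ (f k) + e < n
  below-diagonal zero k _ = subst (_< n) (sym (+-identityʳ _)) (toℕ<n (f k))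
  below-diagonal (suc e) k k+e+1<n with successor k (≤-<-trans (m<m+n (toℕ k) z<s) k+e+1<n)
  ... | k′ , k′≡ = begin-strict
    toℕ (f k) + suc e   ≡⟨ +-suc (toℕ (f k)) e ⟩
    suc (toℕ (f k)) + e ≤⟨ +-monoˡ-≤ e (increasing k k′ k′≡) ⟩
    toℕ (f k′) + e      <⟨ below-diagonal e k′ k′+e<n ⟩
    n                   ∎
    where
    open ≤-Reasoning
    k′+e<n : toℕ k′ + e < n
    k′+e<n = subst (λ t → t + e < n) (sym k′≡) (subst (_< n) (+-suc (toℕ k) e) k+e+1<n)

  identity : ∀ k → f k ≡ k
  identity k = toℕ-injective (≤-antisym (s≤s⁻¹ fk<k+1) (above-diagonal (toℕ k) k refl))
    where
    room : ℕ
    room = n ∸ suc (toℕ k)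
    k+1+room≡n : suc (toℕ k) + room ≡ n
    k+1+room≡n = m+[n∸m]≡n (toℕ<n k)
    fk<k+1 : toℕ (f k) < suc (toℕ k)
    fk<k+1 = +-cancelʳ-< room (toℕ (f k)) (suc (toℕ k))
      (subst (toℕ (f k) + room <_) (sym k+1+room≡n) (below-diagonal room k (≤-reflexive k+1+room≡n)))

-- Bubble sort of a permutation γ preserving the blocks of a set D of joins, for a
-- permutation α decreasing on each block: every swap is a cover relation from α ∘ γ.
module BubbleSort {n} (α : Permutation′ n) (D : ℕ → Set)
  (decreasing : ∀ {p q : Fin n} → toℕ p < toℕ q → Blocks.JoinedUpTo D (pos p) (pos q) →
                toℕ (α ⟨$⟩ʳ q) < toℕ (α ⟨$⟩ʳ p)) where
  open Blocks D

  PreservesBlocks : Permutation′ n → Set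
  PreservesBlocks γ = ∀ k → SameBlock (pos k) (pos (γ ⟨$⟩ʳ k))

  AdjacentDescent : Permutation′ n → Fin n → Fin n → Set
  AdjacentDescent γ i i′ = toℕ i′ ≡ suc (toℕ i) × toℕ (γ ⟨$⟩ʳ i′) < toℕ (γ ⟨$⟩ʳ i)

  adjacentDescent? : ∀ γ → Dec (∃[ i ] ∃[ i′ ] AdjacentDescent γ i i′)
  adjacentDescent? γ = any? λ i → any? λ i′ →
    (toℕ i′ ≟ suc (toℕ i)) ×-dec (toℕ (γ ⟨$⟩ʳ i′) <? toℕ (γ ⟨$⟩ʳ i))

  -- without adjacent descents the injective map γ increases at every step
  no-descent⇒identity : ∀ γ → ¬ (∃[ i ] ∃[ i′ ] AdjacentDescent γ i i′) → ∀ k → γ ⟨$⟩ʳ k ≡ k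
  no-descent⇒identity γ none = IncreasingSelfMap.identity (γ ⟨$⟩ʳ_) increasing
    where
    increasing : ∀ i i′ → toℕ i′ ≡ suc (toℕ i) → toℕ (γ ⟨$⟩ʳ i) < toℕ (γ ⟨$⟩ʳ i′)
    increasing i i′ i′≡ = ≤∧≢⇒< (≮⇒≥ (λ γi′<γi → none (i , i′ , i′≡ , γi′<γi)))
      (λ γi≡γi′ → adjacent-distinct i′≡ (permutation-injective γ (toℕ-injective γi≡γi′)))

  module Swap (γ : Permutation′ n) (preserves : PreservesBlocks γ) {i i′ : Fin n}
              (i′≡ : toℕ i′ ≡ suc (toℕ i)) (γi′<γi : toℕ (γ ⟨$⟩ʳ i′) < toℕ (γ ⟨$⟩ʳ i)) where

    swapped : Permutation′ n
    swapped = Perm.transpose i i′ ∘ₚ γ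

    -- γ sends i above γ i′ although i < i′, so their blocks overlap
    same-block : SameBlock (pos i) (pos i′)
    same-block = crossing (preserves i) (preserves i′)
                          (s≤s (≤-trans (n≤1+n (toℕ i)) (≤-reflexive (sym i′≡)))) (s≤s (<⇒≤ γi′<γi))

    -- the transposition moves k within its block, which γ then maps into itself
    swapped-preserves : PreservesBlocks swapped
    swapped-preserves k = sameBlock-trans
      (transpose-related (λ a b → SameBlock (pos a) (pos b)) sameBlock-refl sameBlock-sym
                         (adjacent-distinct i′≡) same-block k)
      (preserves (transpose i i′ k))

    -- γ i′ and γ i lie in the block of i, on which α decreases
    covers : Cover (α ⊚ γ) (α ⊚ swapped)
    covers = i , i′ , i′≡ , decreasing γi′<γi (proj₁ images-same-block) , λ _ → refl
      where
      images-same-block : SameBlock (pos (γ ⟨$⟩ʳ i′)) (pos (γ ⟨$⟩ʳ i))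
      images-same-block = sameBlock-trans (sameBlock-sym (preserves i′))
                            (sameBlock-trans (sameBlock-sym same-block) (preserves i))

  sort : ∀ γ → Acc _<_ (Φ γ) → PreservesBlocks γ → (α ⊚ γ) ≤W α
  sort γ (acc smaller) preserves with adjacentDescent? γ
  ... | yes (i , i′ , i′≡ , γi′<γi) =
    ≤W-step covers (sort swapped (smaller (Φ-swap γ i′≡ γi′<γi)) swapped-preserves)
    where open Swap γ preserves i′≡ γi′<γi
  ... | no none = ≤W-refl (λ k → cong (α ⟨$⟩ʳ_) (no-descent⇒identity γ none k))

-- The column group of c preserves the blocks of the joins innerSums c, and α decreases
-- on these blocks since its joins are descents of α; bubble sort then applies.
lemma6p2 : (n : ℕ) (c : List ℕ) → IsCompositionLastPos n c →
    (α : Permutation′ n) → descentComposition α ≡ c →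
    (γ : Permutation′ n) → InColumnGroup c γ →
    (α ⊚ γ) ≤W α
lemma6p2 n c _ α α-has-c γ γ-in-columns =
  BubbleSort.sort α columnJoin decreasing γ (<-wellFounded (Φ γ)) preserves
  where
  columnJoin : ℕ → Set
  columnJoin j = j ∈ innerSums c
  open DecreasingOnBlocks α
  decreasing : ∀ {p q : Fin n} → toℕ p < toℕ q → Blocks.JoinedUpTo columnJoin (pos p) (pos q) → value q < value p
  decreasing p<q joined = decreasing-on-blocks p<q
    (λ j p≤j j<q → joins-are-descents α j
                     (subst (λ c′ → j ∈ innerSums c′) (sym α-has-c) (joined j p≤j j<q)))
  preserves : BubbleSort.PreservesBlocks α columnJoin decreasing γ
  preserves k = Blocks.sameBlock-fromMinMax columnJoin (γ-in-columns k)
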